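{- Let $n \geq 2$ be an integer and let $G = C_n(S)$ be a circulant graph with $S \subseteq \{1, 2, \ldots, \lfloor n/2 \rfloor\}$. If $G$ is not a complete graph, then its clique number satisfies $$\omega(G) \leq \Big\lfloor \frac{n}{2} \Big\rfloor .$$
   Context: For $S \subseteq \{1,\ldots,\lfloor n/2\rfloor\}$, the circulant graph $C_n(S)$ is the simple graph with vertex set $\mathbb{Z}_n=\{0,\ldots,n-1\}$ and edge set $\{\{i,j\} : |j-i|_n \in S\}$, where $|k|_n=\min\{|k|, n-|k|\}$ (with $k$ taken as a representative in $\{0,\ldots,n-1\}$). A clique is a set of pairwise adjacent vertices; $\omega(G)$ is the maximum cardinality of a clique of $G$. -}

module Defs where

open import Data.Nat using (ℕ; _≤_; _⊓_; _∸_; ∣_-_∣; _/_)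
open import Data.Fin using (Fin; toℕ)
open import Data.Fin.Subset using (Subset; _∈_)
open import Data.Product using (_×_)
open import Relation.Binary.PropositionalEquality using (_≡_)
open import Relation.Nullary using (¬_)

circDist : (n : ℕ) → Fin n → Fin n → ℕ
circDist n i j = ∣ toℕ j - toℕ i ∣ ⊓ (n ∸ ∣ toℕ j - toℕ i ∣)

ConnSet : Set₁
ConnSet = ℕ → Set

Adj : (n : ℕ) → ConnSet → Fin n → Fin n → Set
Adj n S i j = ¬ (i ≡ j) × S (circDist n i j)

ValidConn : (n : ℕ) → ConnSet → Set
ValidConn n S = ∀ k → S k → (1 ≤ k × k ≤ n / 2)

IsComplete : (n : ℕ) → ConnSet → Set
IsComplete n S = ∀ (i j : Fin n) → ¬ (i ≡ j) → Adj n S i j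

IsClique : (n : ℕ) → ConnSet → Subset n → Set
IsClique n S C = ∀ (i j : Fin n) → i ∈ C → j ∈ C → ¬ (i ≡ j) → Adj n S i j

-- Suppose 2∣C∣ > n. Rotation of ℤ_n by e is a permutation, so C and its
-- preimage under the rotation have more than n elements together and must
-- meet: some x ∈ C has x + e ∈ C too, and the edge between them puts e into S.
-- Hence every distance between distinct vertices lies in S, i.e. C_n(S) is
-- complete.
module Submission where

open import Defs
open import Data.Nat using (ℕ; _≤_; _/_)
open import Data.Fin.Subset using (Subset; ∣_∣)
open import Relation.Nullary using (¬_)

open import Data.Nat
  using (NonZero; >-nonZero; z<s; _+_; _*_; _∸_; _<_; _⊓_; ∣_-_∣; _%_; _<?_; _≤?_)
open import Data.Nat.Properties
open import Data.Nat.DivMod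
  using (_mod_; m%n<n; %-distribˡ-+; m%n%n≡m%n; [m+n]%n≡m%n; m<n⇒m%n≡m;
         m≤n⇒[n∸m]%m≡n%m; /-monoˡ-≤; m*n/n≡m)
open import Data.Bool using (Bool; true; false)
open import Data.Vec using ([]; _∷_; lookup; tabulate)
open import Data.Vec.Properties using (lookup∘tabulate; []=⇒lookup; lookup⇒[]=)
open import Data.Fin using (Fin; toℕ)
open import Data.Fin.Properties using (toℕ<n; toℕ-fromℕ<; toℕ-injective)
open import Data.Fin.Permutation using (Permutation′; permutation; _⟨$⟩ʳ_)
open import Data.Fin.Subset using (_∈_; _∩_; ∁; _⊆_; Nonempty)
open import Data.Fin.Subset.Properties
  using (nonempty?; x∈p∩q⁺; p∩q⊆p; p∩q⊆q; x∉p⇒x∈∁p; p⊆q⇒∣p∣≤∣q∣; ∣∁p∣≡n∸∣p∣; ∣p∣≤n)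
open import Algebra.Properties.CommutativeMonoid.Sum +-0-commutativeMonoid
  using (sum; sum-permute; sum-cong-≗)
open import Data.Product using (_,_; proj₂)
open import Data.Sum using (_⊎_; inj₁; inj₂)
open import Function using (_∘_)
open import Relation.Nullary using (yes; no; contradiction)
open import Relation.Binary.PropositionalEquality

indicator : Bool → ℕ
indicator true  = 1
indicator false = 0

∣p∣≡sum : ∀ {n} (p : Subset n) → ∣ p ∣ ≡ sum (indicator ∘ lookup p)
∣p∣≡sum []          = refl
∣p∣≡sum (true  ∷ p) = cong (1 +_) (∣p∣≡sum p)
∣p∣≡sum (false ∷ p) = ∣p∣≡sum p

preimage : ∀ {m n} → (Fin m → Fin n) → Subset n → Subset m
preimage f p = tabulate (lookup p ∘ f)

x∈preimage⇒fx∈p : ∀ {m n} (f : Fin m → Fin n) (p : Subset n) {x} →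
                  x ∈ preimage f p → f x ∈ p
x∈preimage⇒fx∈p f p {x} x∈ =
  lookup⇒[]= (f x) p (trans (sym (lookup∘tabulate (lookup p ∘ f) x)) ([]=⇒lookup x∈))

∣preimage∣≡∣p∣ : ∀ {n} (π : Permutation′ n) (p : Subset n) →
                 ∣ preimage (π ⟨$⟩ʳ_) p ∣ ≡ ∣ p ∣
∣preimage∣≡∣p∣ π p = begin
  ∣ preimage (π ⟨$⟩ʳ_) p ∣            ≡⟨ ∣p∣≡sum (preimage (π ⟨$⟩ʳ_) p) ⟩
  sum (indicator ∘ lookup (preimage (π ⟨$⟩ʳ_) p))
    ≡⟨ sum-cong-≗ (cong indicator ∘ lookup∘tabulate (lookup p ∘ (π ⟨$⟩ʳ_))) ⟩
  sum (indicator ∘ lookup p ∘ (π ⟨$⟩ʳ_)) ≡⟨ sum-permute (indicator ∘ lookup p) π ⟨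
  sum (indicator ∘ lookup p)            ≡⟨ ∣p∣≡sum p ⟨
  ∣ p ∣                                 ∎
  where open ≡-Reasoning

∣p∣+∣q∣≤n⊎∩-nonempty : ∀ {n} (p q : Subset n) → ∣ p ∣ + ∣ q ∣ ≤ n ⊎ Nonempty (p ∩ q)
∣p∣+∣q∣≤n⊎∩-nonempty {n} p q with nonempty? (p ∩ q)
... | yes p∩q≢∅ = inj₂ p∩q≢∅
... | no  p∩q≡∅ = inj₁ (begin
  ∣ p ∣ + ∣ q ∣       ≤⟨ +-monoˡ-≤ ∣ q ∣ (p⊆q⇒∣p∣≤∣q∣ p⊆∁q) ⟩
  ∣ ∁ q ∣ + ∣ q ∣     ≡⟨ cong (_+ ∣ q ∣) (∣∁p∣≡n∸∣p∣ q) ⟩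
  (n ∸ ∣ q ∣) + ∣ q ∣ ≡⟨ m∸n+n≡m (∣p∣≤n q) ⟩
  n                   ∎)
  where
  open ≤-Reasoning
  p⊆∁q : p ⊆ ∁ q
  p⊆∁q x∈p = x∉p⇒x∈∁p (λ x∈q → p∩q≡∅ (_ , x∈p∩q⁺ (x∈p , x∈q)))

circDist-sym : ∀ n (i j : Fin n) → circDist n i j ≡ circDist n j i
circDist-sym n i j = cong (λ t → t ⊓ (n ∸ t)) (∣-∣-comm (toℕ j) (toℕ i))

circDist-refl : ∀ n (i : Fin n) → circDist n i i ≡ 0
circDist-refl n i rewrite ∣n-n∣≡0 (toℕ i) = refl

circDist-+ : ∀ n {i j : Fin n} d → toℕ j ≡ toℕ i + d → circDist n i j ≡ d ⊓ (n ∸ d)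
circDist-+ n {i} d j≡i+d rewrite j≡i+d | ∣-∣-comm (toℕ i + d) (toℕ i) | ∣m-m+n∣≡n (toℕ i) d = refl

∣j-i∣<n : ∀ {n} (i j : Fin n) → ∣ toℕ j - toℕ i ∣ < n
∣j-i∣<n i j = ≤-<-trans (∣m-n∣≤m⊔n (toℕ j) (toℕ i)) (⊔-pres-<m (toℕ<n j) (toℕ<n i))

m⊓[n∸m]≤n∸[m⊓[n∸m]] : ∀ {m n} → m ≤ n → m ⊓ (n ∸ m) ≤ n ∸ (m ⊓ (n ∸ m))
m⊓[n∸m]≤n∸[m⊓[n∸m]] {m} {n} m≤n with ≤-total m (n ∸ m)
... | inj₁ m≤n∸m rewrite m≤n⇒m⊓n≡m m≤n∸m = m≤n∸m
... | inj₂ n∸m≤m rewrite m≥n⇒m⊓n≡n n∸m≤m | m∸[m∸n]≡n m≤n = n∸m≤m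

circDist≤n∸circDist : ∀ n (i j : Fin n) → circDist n i j ≤ n ∸ circDist n i j
circDist≤n∸circDist n i j = m⊓[n∸m]≤n∸[m⊓[n∸m]] (<⇒≤ (∣j-i∣<n i j))

0<circDist : ∀ n {i j : Fin n} → ¬ i ≡ j → 0 < circDist n i j
0<circDist n {i} {j} i≢j = ⊓-pres-m< 0<t (m<n⇒0<n∸m (∣j-i∣<n i j))
  where
  0<t : 0 < ∣ toℕ j - toℕ i ∣
  0<t = n≢0⇒n>0 (λ t≡0 → i≢j (toℕ-injective (sym (∣m-n∣≡0⇒m≡n t≡0))))

module _ {n : ℕ} .{{_ : NonZero n}} where

  rotate : ℕ → Fin n → Fin n
  rotate e i = (toℕ i + e) mod n

  toℕ-rotate : ∀ e i → toℕ (rotate e i) ≡ (toℕ i + e) % n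
  toℕ-rotate e i = toℕ-fromℕ< (m%n<n (toℕ i + e) n)

  rotate-rotate : ∀ d e i → rotate d (rotate e i) ≡ rotate (e + d) i
  rotate-rotate d e i = toℕ-injective (begin
    toℕ (rotate d (rotate e i))    ≡⟨ toℕ-rotate d (rotate e i) ⟩
    (toℕ (rotate e i) + d) % n     ≡⟨ cong (λ k → (k + d) % n) (toℕ-rotate e i) ⟩
    ((toℕ i + e) % n + d) % n      ≡⟨ %-distribˡ-+ ((toℕ i + e) % n) d n ⟩
    ((toℕ i + e) % n % n + d % n) % n
      ≡⟨ cong (λ k → (k + d % n) % n) (m%n%n≡m%n (toℕ i + e) n) ⟩
    ((toℕ i + e) % n + d % n) % n  ≡⟨ %-distribˡ-+ (toℕ i + e) d n ⟨
    (toℕ i + e + d) % n            ≡⟨ cong (_% n) (+-assoc (toℕ i) e d) ⟩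
    (toℕ i + (e + d)) % n          ≡⟨ toℕ-rotate (e + d) i ⟨
    toℕ (rotate (e + d) i)         ∎)
    where open ≡-Reasoning

  rotate-n : ∀ i → rotate n i ≡ i
  rotate-n i = toℕ-injective (begin
    toℕ (rotate n i)  ≡⟨ toℕ-rotate n i ⟩
    (toℕ i + n) % n   ≡⟨ [m+n]%n≡m%n (toℕ i) n ⟩
    toℕ i % n         ≡⟨ m<n⇒m%n≡m (toℕ<n i) ⟩
    toℕ i             ∎)
    where open ≡-Reasoning

  rotation : ∀ {e} → e ≤ n → Permutation′ n
  rotation {e} e≤n = permutation (rotate e) (rotate (n ∸ e)) undo-e undo-n∸e
    where
    undo-e : ∀ i → rotate e (rotate (n ∸ e) i) ≡ i
    undo-e i rewrite rotate-rotate e (n ∸ e) i | m∸n+n≡m e≤n = rotate-n i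
    undo-n∸e : ∀ i → rotate (n ∸ e) (rotate e i) ≡ i
    undo-n∸e i rewrite rotate-rotate (n ∸ e) e i | m+[n∸m]≡n e≤n = rotate-n i

  toℕ-rotate-< : ∀ {e} i → toℕ i + e < n → toℕ (rotate e i) ≡ toℕ i + e
  toℕ-rotate-< {e} i i+e<n = trans (toℕ-rotate e i) (m<n⇒m%n≡m i+e<n)

  toℕ-rotate-≥ : ∀ {e} i → e ≤ n → n ≤ toℕ i + e → toℕ i ≡ toℕ (rotate e i) + (n ∸ e)
  toℕ-rotate-≥ {e} i e≤n n≤i+e =
    +-cancelʳ-≡ e (toℕ i) (toℕ (rotate e i) + (n ∸ e)) (begin
      toℕ i + e                       ≡⟨ m∸n+n≡m n≤i+e ⟨
      r + n                           ≡⟨ cong (r +_) (m∸n+n≡m e≤n) ⟨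
      r + (n ∸ e + e)                 ≡⟨ +-assoc r (n ∸ e) e ⟨
      r + (n ∸ e) + e                 ≡⟨ cong (λ k → k + (n ∸ e) + e) toℕ-rotate≡r ⟨
      toℕ (rotate e i) + (n ∸ e) + e  ∎)
    where
    open ≡-Reasoning
    r : ℕ
    r = toℕ i + e ∸ n
    r<n : r < n
    r<n = m<n+o⇒m∸n<o (toℕ i + e) n (+-mono-<-≤ (toℕ<n i) e≤n)
    toℕ-rotate≡r : toℕ (rotate e i) ≡ r
    toℕ-rotate≡r = begin
      toℕ (rotate e i)   ≡⟨ toℕ-rotate e i ⟩
      (toℕ i + e) % n    ≡⟨ m≤n⇒[n∸m]%m≡n%m n≤i+e ⟨
      r % n              ≡⟨ m<n⇒m%n≡m r<n ⟩
      r                  ∎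

  circDist-rotate : ∀ {e} → e ≤ n ∸ e → ∀ i → circDist n i (rotate e i) ≡ e
  circDist-rotate {e} e≤n∸e i with toℕ i + e <? n
  ... | yes i+e<n = begin
    circDist n i (rotate e i)  ≡⟨ circDist-+ n e (toℕ-rotate-< i i+e<n) ⟩
    e ⊓ (n ∸ e)                ≡⟨ m≤n⇒m⊓n≡m e≤n∸e ⟩
    e                          ∎
    where open ≡-Reasoning
  ... | no i+e≮n = begin
    circDist n i (rotate e i)  ≡⟨ circDist-sym n i (rotate e i) ⟩
    circDist n (rotate e i) i  ≡⟨ circDist-+ n (n ∸ e) (toℕ-rotate-≥ i e≤n (≮⇒≥ i+e≮n)) ⟩
    (n ∸ e) ⊓ (n ∸ (n ∸ e))    ≡⟨ cong ((n ∸ e) ⊓_) (m∸[m∸n]≡n e≤n) ⟩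
    (n ∸ e) ⊓ e                ≡⟨ m≥n⇒m⊓n≡n e≤n∸e ⟩
    e                          ∎
    where
    open ≡-Reasoning
    e≤n : e ≤ n
    e≤n = ≤-trans e≤n∸e (m∸n≤m n e)

  large-clique⇒distance∈S : ∀ S {C} → IsClique n S C → n < ∣ C ∣ + ∣ C ∣ →
                            ∀ {e} → 0 < e → e ≤ n ∸ e → S e
  large-clique⇒distance∈S S {C} C-clique n<∣C∣+∣C∣ {e} 0<e e≤n∸e
    with ∣p∣+∣q∣≤n⊎∩-nonempty C (preimage (rotate e) C)
  ... | inj₁ ∣C∣+∣C∘rotate∣≤n = contradiction ∣C∣+∣C∣≤n (<⇒≱ n<∣C∣+∣C∣)
    where
    ∣C∣+∣C∣≤n : ∣ C ∣ + ∣ C ∣ ≤ n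
    ∣C∣+∣C∣≤n = subst (λ k → ∣ C ∣ + k ≤ n)
      (∣preimage∣≡∣p∣ (rotation (≤-trans e≤n∸e (m∸n≤m n e))) C) ∣C∣+∣C∘rotate∣≤n
  ... | inj₂ (i , i∈C∩C∘rotate) =
    subst S (circDist-rotate e≤n∸e i) (proj₂ (C-clique i (rotate e i) i∈C rotate-i∈C i≢rotate-i))
    where
    i∈C : i ∈ C
    i∈C = p∩q⊆p C (preimage (rotate e) C) i∈C∩C∘rotate
    rotate-i∈C : rotate e i ∈ C
    rotate-i∈C = x∈preimage⇒fx∈p (rotate e) C (p∩q⊆q C (preimage (rotate e) C) i∈C∩C∘rotate)
    i≢rotate-i : ¬ i ≡ rotate e i
    i≢rotate-i i≡rotate-i = <⇒≢ 0<e (begin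
      0                          ≡⟨ circDist-refl n i ⟨
      circDist n i i             ≡⟨ cong (circDist n i) i≡rotate-i ⟩
      circDist n i (rotate e i)  ≡⟨ circDist-rotate e≤n∸e i ⟩
      e                          ∎)
      where open ≡-Reasoning

m+m≤n⇒m≤n/2 : ∀ {m n} → m + m ≤ n → m ≤ n / 2
m+m≤n⇒m≤n/2 {m} {n} m+m≤n = subst (_≤ n / 2) (m*n/n≡m m 2) (/-monoˡ-≤ 2 m*2≤n)
  where
  m*2≤n : m * 2 ≤ n
  m*2≤n = subst (_≤ n) (trans (cong (m +_) (sym (+-identityʳ m))) (*-comm 2 m)) m+m≤n

lemma2p2 : (n : ℕ) → 2 ≤ n → (S : ConnSet) → ValidConn n S →
    ¬ IsComplete n S →
    (C : Subset n) → IsClique n S C → ∣ C ∣ ≤ n / 2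
lemma2p2 n 2≤n S _ incomplete C C-clique with ∣ C ∣ ≤? n / 2
... | yes ∣C∣≤n/2 = ∣C∣≤n/2
... | no  ∣C∣≰n/2 = contradiction complete incomplete
  where
  instance
    n≢0 : NonZero n
    n≢0 = >-nonZero (<-≤-trans z<s 2≤n)
  n<∣C∣+∣C∣ : n < ∣ C ∣ + ∣ C ∣
  n<∣C∣+∣C∣ = ≰⇒> (∣C∣≰n/2 ∘ m+m≤n⇒m≤n/2)
  complete : IsComplete n S
  complete i j i≢j = i≢j , large-clique⇒distance∈S S C-clique n<∣C∣+∣C∣
    (0<circDist n i≢j) (circDist≤n∸circDist n i j)
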